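{- Let $G\neq1$ be a finite abelian group and $a,b\in G$ with $o(a),o(b)\ge3$; put $R=\{a,a^{ -1}\}$, $L=\{b,b^{ -1}\}$ and suppose $R\cap L=\emptyset$ and $\Gamma=\mathrm{SC}(G;R,L,\{1\})$ is connected. If $\Gamma$ is intransitive, then $\Gamma$ is normal.
   Context: $\mathrm{SC}(G;R,L,\{1\})$ is the graph with vertex set $G\times\{1,2\}$ and edges $\{(x,1),(y,1)\}$ for $yx^{ -1}\in R$, $\{(x,2),(y,2)\}$ for $yx^{ -1}\in L$, and $\{(x,1),(x,2)\}$ for $x\in G$. $R_G=\{\rho_g\mid g\in G\}$ where $(x,i)^{\rho_g}=(xg,i)$; $\Gamma$ is normal if $R_G\trianglelefteq\mathrm{Aut}(\Gamma)$. Intransitive means $\mathrm{Aut}(\Gamma)$ is not transitive on vertices. -}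

module Defs where

open import Level using (0ℓ)
open import Data.Nat using (ℕ; zero; suc; _<_; _≤_)
open import Data.Fin using (Fin)
open import Data.Product using (_×_; _,_; proj₁; proj₂; Σ; ∃; ∃-syntax)
open import Data.Sum using (_⊎_)
open import Relation.Nullary using (¬_)
open import Data.Empty using (⊥)
open import Relation.Binary.PropositionalEquality using (_≡_; _≢_)
open import Relation.Binary.Construct.Closure.ReflexiveTransitive using (Star)
open import Function.Bundles using (_↔_; _⇔_; Inverse)
open import Algebra.Structures using (IsAbelianGroup)

-- A finite abelian group, presented (up to isomorphism) on the carrier Fin n
-- with propositional equality.
record FinAbGroup : Set where
  field
    n       : ℕ
    _∙_     : Fin n → Fin n → Fin n
    ε       : Fin n
    _⁻¹     : Fin n → Fin n
    isAbGrp : IsAbelianGroup (_≡_ {A = Fin n}) _∙_ ε _⁻¹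

module _ (G : FinAbGroup) where
  open FinAbGroup G

  Nontrivial : Set
  Nontrivial = 1 < n

  pow : Fin n → ℕ → Fin n
  pow a zero    = ε
  pow a (suc k) = pow a k ∙ a

  OrderAtLeast3 : Fin n → Set
  OrderAtLeast3 a = ∀ k → 1 ≤ k → k < 3 → pow a k ≢ ε

  _∈±_ : Fin n → Fin n → Set
  z ∈± a = (z ≡ a) ⊎ (z ≡ a ⁻¹)

  Disjoint± : Fin n → Fin n → Set
  Disjoint± a b = ∀ z → z ∈± a → z ∈± b → ⊥

  -- vertex set G × {1,2}; layer 1 = Fin.zero, layer 2 = Fin.suc Fin.zero
  V : Set
  V = Fin n × Fin 2

  data Adj (a b : Fin n) : V → V → Set where
    edge₁ : ∀ x y → (y ∙ (x ⁻¹)) ∈± a → Adj a b (x , Fin.zero) (y , Fin.zero)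
    edge₂ : ∀ x y → (y ∙ (x ⁻¹)) ∈± b → Adj a b (x , Fin.suc Fin.zero) (y , Fin.suc Fin.zero)
    spoke₁₂ : ∀ x → Adj a b (x , Fin.zero) (x , Fin.suc Fin.zero)
    spoke₂₁ : ∀ x → Adj a b (x , Fin.suc Fin.zero) (x , Fin.zero)

  Connected : Fin n → Fin n → Set
  Connected a b = ∀ u v → Star (Adj a b) u v

  PreservesAdj : Fin n → Fin n → (V → V) → Set
  PreservesAdj a b f = ∀ u v → Adj a b u v ⇔ Adj a b (f u) (f v)

  record Aut (a b : Fin n) : Set where
    field
      perm : V ↔ V
      pres : PreservesAdj a b (Inverse.to perm)

  VertexTransitive : Fin n → Fin n → Set
  VertexTransitive a b = ∀ u v → Σ (Aut a b) λ σ → Inverse.to (Aut.perm σ) u ≡ v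

  ρ : Fin n → V → V
  ρ g (x , i) = (x ∙ g , i)

  -- R_G ⊴ Aut(Γ): R_G ≤ Aut(Γ) and σ⁻¹ ρ_g σ ∈ R_G for all σ ∈ Aut(Γ), g ∈ G
  Normal : Fin n → Fin n → Set
  Normal a b =
    (∀ g → PreservesAdj a b (ρ g)) ×
    (∀ (σ : Aut a b) g → ∃[ h ] ∀ v →
        Inverse.from (Aut.perm σ) (ρ g (Inverse.to (Aut.perm σ) v)) ≡ ρ h v)

-- An automorphism σ mapping one layer of Γ into the other makes Γ vertex-transitive,
-- since R_G is transitive on each layer. So if Γ is intransitive, σ fixes both layers
-- and (because of the spokes) acts on both by the same bijection F of G, which maps
-- a-edges to a-edges and b-edges to b-edges. Writing Δ_c(x) = F(xc)F(x)⁻¹, we get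
-- Δ_a(x) ∈ {a, a⁻¹}, Δ_b(x) ∈ {b, b⁻¹}; since o(a), o(b) ≥ 3 these increments are
-- invariant under their own generator, and comparing F on the square x, xa, xb, xab
-- shows that unless a² = b² has order 2 they are invariant under the other generator
-- too. By connectivity they are then constant, F is affine, and σ⁻¹ρ_gσ = ρ_h with
-- F(h) = F(1)g. In the exceptional case a² = b², b⁴ = 1, fixing the elements with
-- x² = 1 and multiplying the others by ab⁻¹ is a bijection of G interchanging the two
-- Cayley graphs, which yields a layer-swapping automorphism: Γ would be transitive.
module Submission where

open import Defs
open import Relation.Nullary using (¬_)
open import Data.Fin using (Fin)

open import Level using (0ℓ)
open import Algebra.Bundles using (AbelianGroup; Group)
import Algebra.Properties.AbelianGroup as AbelianGroupProperties
import Algebra.Properties.CommutativeSemigroup as CommutativeSemigroupProperties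
open import Data.Fin using (zero; suc)
open import Data.Fin.Properties using (_≟_)
open import Data.Nat using (s≤s; z≤n)
open import Data.Product using (_×_; _,_; proj₁; proj₂; Σ; ∃-syntax)
open import Data.Sum using (_⊎_; inj₁; inj₂)
open import Data.Empty using (⊥-elim)
open import Function using (_∘_)
open import Function.Bundles using (Inverse; Equivalence; mk↔ₛ′; mk⇔)
open import Relation.Nullary using (Dec; yes; no)
open import Relation.Nullary.Decidable using (_×-dec_; decidable-stable)
open import Relation.Binary.PropositionalEquality
open import Relation.Binary.Construct.Closure.ReflexiveTransitive as Star using (_◅_)

pattern layer₁ = zero
pattern layer₂ = suc zero

module _ (G : FinAbGroup) where
  open FinAbGroup G using (n; isAbGrp)

  abelianGroup : AbelianGroup 0ℓ 0ℓ
  abelianGroup = record { isAbelianGroup = isAbGrp }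

  open AbelianGroup abelianGroup
    using (_∙_; ε; _⁻¹; assoc; comm; identityˡ; identityʳ; inverseʳ; group;
           commutativeSemigroup)
  open Group group using (_//_; _\\_)
  open AbelianGroupProperties abelianGroup
    using (∙-cancelˡ; inverseʳ-unique; ε⁻¹≈ε; ⁻¹-involutive; ⁻¹-∙-comm; xyx⁻¹≈y;
           //-rightDividesˡ; //-rightDividesʳ; \\-leftDividesˡ; \\-leftDividesʳ)
  open CommutativeSemigroupProperties commutativeSemigroup using (interchange; xy∙z≈xz∙y)
  open ≡-Reasoning

  infixl 10 _²
  _² : Fin n → Fin n
  x ² = x ∙ x

  infix 4 _≡±_
  _≡±_ : Fin n → Fin n → Set
  _≡±_ = _∈±_ G

  orderAtLeast3⇒²≢ε : ∀ {a} → OrderAtLeast3 G a → a ² ≢ ε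
  orderAtLeast3⇒²≢ε {a} o a²≡ε =
    o 2 (s≤s z≤n) (s≤s (s≤s (s≤s z≤n))) (trans (cong (_∙ a) (identityˡ a)) a²≡ε)

  x∙[y//x]≡y : ∀ x y → x ∙ (y // x) ≡ y
  x∙[y//x]≡y x y = trans (comm x (y // x)) (//-rightDividesˡ x y)

  yg//xg≡y//x : ∀ x y g → (y ∙ g) // (x ∙ g) ≡ y // x
  yg//xg≡y//x x y g = begin
    (y ∙ g) ∙ (x ∙ g) ⁻¹     ≡⟨ cong ((y ∙ g) ∙_) (⁻¹-∙-comm x g) ⟨
    (y ∙ g) ∙ (x ⁻¹ ∙ g ⁻¹)  ≡⟨ interchange y g (x ⁻¹) (g ⁻¹) ⟩
    (y // x) ∙ (g ∙ g ⁻¹)    ≡⟨ cong ((y // x) ∙_) (inverseʳ g) ⟩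
    (y // x) ∙ ε             ≡⟨ identityʳ (y // x) ⟩
    y // x                   ∎

  ²-∙ : ∀ x y → (x ∙ y) ² ≡ x ² ∙ y ²
  ²-∙ x y = interchange x y x y

  y²≡x²∙[y//x]² : ∀ x y → y ² ≡ x ² ∙ (y // x) ²
  y²≡x²∙[y//x]² x y = trans (cong _² (sym (x∙[y//x]≡y x y))) (²-∙ x (y // x))

  x≡x⁻¹⇒x²≡ε : ∀ {x} → x ≡ x ⁻¹ → x ² ≡ ε
  x≡x⁻¹⇒x²≡ε {x} x≡x⁻¹ = trans (cong (x ∙_) x≡x⁻¹) (inverseʳ x)

  [p//q]∙[p∙q]≡p² : ∀ p q → (p // q) ∙ (p ∙ q) ≡ p ²
  [p//q]∙[p∙q]≡p² p q = begin
    (p ∙ q ⁻¹) ∙ (p ∙ q)  ≡⟨ interchange p (q ⁻¹) p q ⟩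
    p ² ∙ (q ⁻¹ ∙ q)      ≡⟨ cong (p ² ∙_) (trans (comm (q ⁻¹) q) (inverseʳ q)) ⟩
    p ² ∙ ε               ≡⟨ identityʳ (p ²) ⟩
    p ²                   ∎

  p//q≡q//p⇒p²≡q² : ∀ {p q} → p // q ≡ q // p → p ² ≡ q ²
  p//q≡q//p⇒p²≡q² {p} {q} eq = begin
    p ²                   ≡⟨ [p//q]∙[p∙q]≡p² p q ⟨
    (p // q) ∙ (p ∙ q)    ≡⟨ cong₂ _∙_ eq (comm p q) ⟩
    (q // p) ∙ (q ∙ p)    ≡⟨ [p//q]∙[p∙q]≡p² q p ⟩
    q ²                   ∎

  ≡±-sym : ∀ {z c} → z ≡± c → c ≡± z
  ≡±-sym (inj₁ refl) = inj₁ refl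
  ≡±-sym (inj₂ refl) = inj₂ (sym (⁻¹-involutive _))

  ≡±-² : ∀ {z c} → z ≡± c → z ² ≡± c ²
  ≡±-² (inj₁ refl) = inj₁ refl
  ≡±-² (inj₂ refl) = inj₂ (⁻¹-∙-comm _ _)

  ≡±-self-inverse : ∀ {z c} → z ≡± c → c ⁻¹ ≡ c → z ≡ c
  ≡±-self-inverse (inj₁ refl) _      = refl
  ≡±-self-inverse (inj₂ refl) c⁻¹≡c = c⁻¹≡c

  ≡±-²≡ε : ∀ {z c} → z ≡± c → z ² ≡ ε → c ² ≡ ε
  ≡±-²≡ε z≡±c z²≡ε =
    ≡±-self-inverse (≡±-sym (subst (_≡± _) z²≡ε (≡±-² z≡±c))) ε⁻¹≈ε

  ≡±-≢⇒inverse : ∀ {z w c} → z ≡± c → w ≡± c → z ≢ w → w ≡ z ⁻¹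
  ≡±-≢⇒inverse (inj₁ refl) (inj₁ refl) z≢w = ⊥-elim (z≢w refl)
  ≡±-≢⇒inverse (inj₁ refl) (inj₂ refl) _   = refl
  ≡±-≢⇒inverse (inj₂ refl) (inj₁ refl) _   = sym (⁻¹-involutive _)
  ≡±-≢⇒inverse (inj₂ refl) (inj₂ refl) z≢w = ⊥-elim (z≢w refl)

  module Increments (F : Fin n → Fin n) where

    Δ : Fin n → Fin n → Fin n
    Δ c x = F (x ∙ c) // F x

    F-step : ∀ c x → F (x ∙ c) ≡ F x ∙ Δ c x
    F-step c x = sym (x∙[y//x]≡y (F x) (F (x ∙ c)))

    Δ-square : ∀ c d x → Δ c x ∙ Δ d (x ∙ c) ≡ Δ d x ∙ Δ c (x ∙ d)
    Δ-square c d x = ∙-cancelˡ (F x) _ _ (begin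
      F x ∙ (Δ c x ∙ Δ d (x ∙ c))  ≡⟨ assoc (F x) _ _ ⟨
      F x ∙ Δ c x ∙ Δ d (x ∙ c)    ≡⟨ cong (_∙ Δ d (x ∙ c)) (F-step c x) ⟨
      F (x ∙ c) ∙ Δ d (x ∙ c)      ≡⟨ F-step d (x ∙ c) ⟨
      F (x ∙ c ∙ d)                ≡⟨ cong F (xy∙z≈xz∙y x c d) ⟩
      F (x ∙ d ∙ c)                ≡⟨ F-step c (x ∙ d) ⟩
      F (x ∙ d) ∙ Δ c (x ∙ d)      ≡⟨ cong (_∙ Δ c (x ∙ d)) (F-step d x) ⟩
      F x ∙ Δ d x ∙ Δ c (x ∙ d)    ≡⟨ assoc (F x) _ _ ⟩
      F x ∙ (Δ d x ∙ Δ c (x ∙ d))  ∎)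

    Δ-invariant : (∀ {x y} → F x ≡ F y → x ≡ y) → ∀ {c} → (∀ x → Δ c x ≡± c) →
                  c ² ≢ ε → ∀ x → Δ c (x ∙ c) ≡ Δ c x
    Δ-invariant F-injective {c} Δc≡±c c²≢ε x =
      decidable-stable (Δ c (x ∙ c) ≟ Δ c x) λ Δ≢ → c²≢ε (∙-cancelˡ x _ _ (begin
        x ∙ c ²    ≡⟨ assoc x c c ⟨
        x ∙ c ∙ c  ≡⟨ F-injective (F[xcc]≡F[x] Δ≢) ⟩
        x          ≡⟨ identityʳ x ⟨
        x ∙ ε      ∎))
      where
      F[xcc]≡F[x] : Δ c (x ∙ c) ≢ Δ c x → F (x ∙ c ∙ c) ≡ F x
      F[xcc]≡F[x] Δ≢ = begin
        F (x ∙ c ∙ c)            ≡⟨ F-step c (x ∙ c) ⟩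
        F (x ∙ c) ∙ Δ c (x ∙ c)  ≡⟨ cong (F (x ∙ c) ∙_) Δc[xc]≡Δc[x]⁻¹ ⟩
        F (x ∙ c) ∙ Δ c x ⁻¹     ≡⟨ cong (_// Δ c x) (F-step c x) ⟩
        F x ∙ Δ c x // Δ c x     ≡⟨ //-rightDividesʳ (Δ c x) (F x) ⟩
        F x                      ∎
        where
        Δc[xc]≡Δc[x]⁻¹ : Δ c (x ∙ c) ≡ Δ c x ⁻¹
        Δc[xc]≡Δc[x]⁻¹ = ≡±-≢⇒inverse (Δc≡±c x) (Δc≡±c (x ∙ c)) (Δ≢ ∘ sym)

    Δ-translation-invariant : ∀ c → (∀ x → Δ c x ≡ Δ c ε) → ∀ h x → Δ h (x ∙ c) ≡ Δ h x
    Δ-translation-invariant c Δc-constant h x = begin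
      F (x ∙ c ∙ h) // F (x ∙ c)            ≡⟨ cong (λ y → F y // F (x ∙ c)) (xy∙z≈xz∙y x c h) ⟩
      F (x ∙ h ∙ c) // F (x ∙ c)            ≡⟨ cong₂ _//_ (F-step′ (x ∙ h)) (F-step′ x) ⟩
      (F (x ∙ h) ∙ Δ c ε) // (F x ∙ Δ c ε)  ≡⟨ yg//xg≡y//x (F x) (F (x ∙ h)) (Δ c ε) ⟩
      F (x ∙ h) // F x                      ∎
      where
      F-step′ : ∀ y → F (y ∙ c) ≡ F y ∙ Δ c ε
      F-step′ y = trans (F-step c y) (cong (F y ∙_) (Δc-constant y))

  Swappable : Fin n → Fin n → Set
  Swappable a b = (a ² ≡ b ²) × ((b ²) ² ≡ ε)

  swappable? : ∀ a b → Dec (Swappable a b)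
  swappable? a b = (a ² ≟ b ²) ×-dec ((b ²) ² ≟ ε)

  module _ (a b : Fin n) where

    infix 4 _~_
    _~_ : V G → V G → Set
    _~_ = Adj G a b

    spoke-ends : ∀ {p q} → (p , layer₁) ~ (q , layer₂) → p ≡ q
    spoke-ends (spoke₁₂ _) = refl

    layer₁-edge : ∀ {p q} → (p , layer₁) ~ (q , layer₁) → q // p ≡± a
    layer₁-edge (edge₁ _ _ r) = r

    layer₂-edge : ∀ {p q} → (p , layer₂) ~ (q , layer₂) → q // p ≡± b
    layer₂-edge (edge₂ _ _ r) = r

    Generator : Fin n → Set
    Generator e = e ≡± a ⊎ e ≡± b

    module _ (conn : Connected G a b) where

      generated-induction : (P : Fin n → Set) → P ε →
                            (∀ x e → Generator e → P x → P (x ∙ e)) → ∀ y → P y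
      generated-induction P Pε P-step y = walk (conn (ε , layer₁) (y , layer₁)) Pε
        where
        P-edge : ∀ {u v} → u ~ v → P (proj₁ u) → P (proj₁ v)
        P-edge (edge₁ x y r)  = subst P (x∙[y//x]≡y x y) ∘ P-step x (y // x) (inj₁ r)
        P-edge (edge₂ x y r)  = subst P (x∙[y//x]≡y x y) ∘ P-step x (y // x) (inj₂ r)
        P-edge (spoke₁₂ x)    = λ Px → Px
        P-edge (spoke₂₁ x)    = λ Px → Px
        walk : ∀ {u v} → Star.Star _~_ u v → P (proj₁ u) → P (proj₁ v)
        walk Star.ε        = λ Pu → Pu
        walk (u~w ◅ path)  = walk path ∘ P-edge u~w

      invariant⇒constant : {A : Set} (f : Fin n → A) →
                           (∀ x → f (x ∙ a) ≡ f x) → (∀ x → f (x ∙ b) ≡ f x) →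
                           ∀ x → f x ≡ f ε
      invariant⇒constant f fa fb = generated-induction (λ x → f x ≡ f ε) refl step
        where
        inverse-invariant : ∀ {c} → (∀ x → f (x ∙ c) ≡ f x) → ∀ x → f (x // c) ≡ f x
        inverse-invariant {c} fc x = trans (sym (fc (x // c))) (cong f (//-rightDividesˡ c x))
        step : ∀ x e → Generator e → f x ≡ f ε → f (x ∙ e) ≡ f ε
        step x _ (inj₁ (inj₁ refl)) = trans (fa x)
        step x _ (inj₁ (inj₂ refl)) = trans (inverse-invariant fa x)
        step x _ (inj₂ (inj₁ refl)) = trans (fb x)
        step x _ (inj₂ (inj₂ refl)) = trans (inverse-invariant fb x)

    module CayleyPreserving (F : Fin n → Fin n)
        (F-injective : ∀ {x y} → F x ≡ F y → x ≡ y)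
        (Δa≡±a : ∀ x → Increments.Δ F a x ≡± a) (Δb≡±b : ∀ x → Increments.Δ F b x ≡± b)
        (a²≢ε : a ² ≢ ε) (b²≢ε : b ² ≢ ε) where
      open Increments F public

      Δa-a-invariant : ∀ x → Δ a (x ∙ a) ≡ Δ a x
      Δa-a-invariant = Δ-invariant F-injective Δa≡±a a²≢ε

      Δb-b-invariant : ∀ x → Δ b (x ∙ b) ≡ Δ b x
      Δb-b-invariant = Δ-invariant F-injective Δb≡±b b²≢ε

      Δa-b-variant⇒square : ∀ x → Δ a (x ∙ b) ≢ Δ a x → Δ a x ∙ Δ b (x ∙ a) ≡ Δ b x // Δ a x
      Δa-b-variant⇒square x Δa≢ = trans (Δ-square a b x)
        (cong (Δ b x ∙_) (≡±-≢⇒inverse (Δa≡±a x) (Δa≡±a (x ∙ b)) (Δa≢ ∘ sym)))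

      Δa-b-variant⇒squares-agree : ∀ x → Δ a (x ∙ b) ≢ Δ a x →
                                   (Δ a x) ² ≡ (Δ b x) ² × Δ b (x ∙ a) ≡ Δ b x ⁻¹
      Δa-b-variant⇒squares-agree x Δa≢ with Δ b (x ∙ a) ≟ Δ b x
      ... | yes Δb≡ = ⊥-elim (a²≢ε (≡±-²≡ε (Δa≡±a x) (x≡x⁻¹⇒x²≡ε Δax≡Δax⁻¹)))
        where
        Δax≡Δax⁻¹ : Δ a x ≡ Δ a x ⁻¹
        Δax≡Δax⁻¹ = ∙-cancelˡ (Δ b x) _ _ (begin
          Δ b x ∙ Δ a x        ≡⟨ comm (Δ b x) (Δ a x) ⟩
          Δ a x ∙ Δ b x        ≡⟨ cong (Δ a x ∙_) Δb≡ ⟨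
          Δ a x ∙ Δ b (x ∙ a)  ≡⟨ Δa-b-variant⇒square x Δa≢ ⟩
          Δ b x ∙ Δ a x ⁻¹     ∎)
      ... | no Δb≢ = p//q≡q//p⇒p²≡q² Δa//Δb≡Δb//Δa , Δb⁻¹
        where
        Δb⁻¹ : Δ b (x ∙ a) ≡ Δ b x ⁻¹
        Δb⁻¹ = ≡±-≢⇒inverse (Δb≡±b x) (Δb≡±b (x ∙ a)) (Δb≢ ∘ sym)
        Δa//Δb≡Δb//Δa : Δ a x // Δ b x ≡ Δ b x // Δ a x
        Δa//Δb≡Δb//Δa = trans (cong (Δ a x ∙_) (sym Δb⁻¹)) (Δa-b-variant⇒square x Δa≢)

      Δa-b-variant⇒swappable : ∀ x → Δ a (x ∙ b) ≢ Δ a x → Swappable a b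
      Δa-b-variant⇒swappable x Δa≢ = a²≡b² , b⁴≡ε
        where
        B = (Δ b x) ²
        at-x = Δa-b-variant⇒squares-agree x Δa≢
        Δa≢′ : Δ a (x ∙ a ∙ b) ≢ Δ a (x ∙ a)
        Δa≢′ eq = Δa≢ (begin
          Δ a (x ∙ b)      ≡⟨ Δa-a-invariant (x ∙ b) ⟨
          Δ a (x ∙ b ∙ a)  ≡⟨ cong (Δ a) (xy∙z≈xz∙y x b a) ⟩
          Δ a (x ∙ a ∙ b)  ≡⟨ eq ⟩
          Δ a (x ∙ a)      ≡⟨ Δa-a-invariant x ⟩
          Δ a x            ∎)
        B⁻¹≡B : B ⁻¹ ≡ B
        B⁻¹≡B = begin
          B ⁻¹                   ≡⟨ ⁻¹-∙-comm (Δ b x) (Δ b x) ⟨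
          (Δ b x ⁻¹) ²           ≡⟨ cong _² (proj₂ at-x) ⟨
          (Δ b (x ∙ a)) ²        ≡⟨ proj₁ (Δa-b-variant⇒squares-agree (x ∙ a) Δa≢′) ⟨
          (Δ a (x ∙ a)) ²        ≡⟨ cong _² (Δa-a-invariant x) ⟩
          (Δ a x) ²              ≡⟨ proj₁ at-x ⟩
          B                      ∎
        b²≡B : b ² ≡ B
        b²≡B = ≡±-self-inverse (≡±-sym (≡±-² (Δb≡±b x))) B⁻¹≡B
        a²≡B : a ² ≡ B
        a²≡B = ≡±-self-inverse (≡±-sym (subst (_≡± a ²) (proj₁ at-x) (≡±-² (Δa≡±a x)))) B⁻¹≡B
        a²≡b² : a ² ≡ b ²
        a²≡b² = trans a²≡B (sym b²≡B)
        b⁴≡ε : (b ²) ² ≡ ε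
        b⁴≡ε = trans (cong _² b²≡B) (x≡x⁻¹⇒x²≡ε (sym B⁻¹≡B))

      module _ (¬sw : ¬ Swappable a b) where

        Δa-b-invariant : ∀ x → Δ a (x ∙ b) ≡ Δ a x
        Δa-b-invariant x = decidable-stable (_ ≟ _) (¬sw ∘ Δa-b-variant⇒swappable x)

        Δb-a-invariant : ∀ x → Δ b (x ∙ a) ≡ Δ b x
        Δb-a-invariant x = ∙-cancelˡ (Δ a x) _ _ (begin
          Δ a x ∙ Δ b (x ∙ a)  ≡⟨ Δ-square a b x ⟩
          Δ b x ∙ Δ a (x ∙ b)  ≡⟨ cong (Δ b x ∙_) (Δa-b-invariant x) ⟩
          Δ b x ∙ Δ a x        ≡⟨ comm (Δ b x) (Δ a x) ⟩
          Δ a x ∙ Δ b x        ∎)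

        unswappable⇒Δ-constant : Connected G a b → ∀ h x → Δ h x ≡ Δ h ε
        unswappable⇒Δ-constant conn h = invariant⇒constant conn (Δ h)
          (Δ-translation-invariant a Δa-constant h) (Δ-translation-invariant b Δb-constant h)
          where
          Δa-constant : ∀ x → Δ a x ≡ Δ a ε
          Δa-constant = invariant⇒constant conn (Δ a) Δa-a-invariant Δa-b-invariant
          Δb-constant : ∀ x → Δ b x ≡ Δ b ε
          Δb-constant = invariant⇒constant conn (Δ b) Δb-a-invariant Δb-b-invariant

    to from : Aut G a b → V G → V G
    to σ = Inverse.to (Aut.perm σ)
    from σ = Inverse.from (Aut.perm σ)

    to-from : ∀ σ v → to σ (from σ v) ≡ v
    to-from σ = Inverse.strictlyInverseˡ (Aut.perm σ)

    from-to : ∀ σ v → from σ (to σ v) ≡ v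
    from-to σ = Inverse.strictlyInverseʳ (Aut.perm σ)

    to≡⇒from≡ : ∀ σ {v w} → to σ v ≡ w → from σ w ≡ v
    to≡⇒from≡ σ refl = from-to σ _

    to-preserves : ∀ σ {u v} → u ~ v → to σ u ~ to σ v
    to-preserves σ = Equivalence.to (Aut.pres σ _ _)

    from-preserves : ∀ σ {u v} → u ~ v → from σ u ~ from σ v
    from-preserves σ {u} {v} u~v =
      Equivalence.from (Aut.pres σ _ _) (subst₂ _~_ (sym (to-from σ u)) (sym (to-from σ v)) u~v)

    mkAut : (f f⁻¹ : V G → V G) → (∀ v → f (f⁻¹ v) ≡ v) → (∀ v → f⁻¹ (f v) ≡ v) →
            (∀ {u v} → u ~ v → f u ~ f v) → (∀ {u v} → u ~ v → f⁻¹ u ~ f⁻¹ v) → Aut G a b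
    mkAut f f⁻¹ ff⁻¹ f⁻¹f f-pres f⁻¹-pres = record
      { perm = mk↔ₛ′ f f⁻¹ ff⁻¹ f⁻¹f
      ; pres = λ u v → mk⇔ f-pres (subst₂ _~_ (f⁻¹f u) (f⁻¹f v) ∘ f⁻¹-pres)
      }

    Aut-compose : Aut G a b → Aut G a b → Aut G a b
    Aut-compose σ τ = mkAut (to τ ∘ to σ) (from σ ∘ from τ)
      (λ v → trans (cong (to τ) (to-from σ (from τ v))) (to-from τ v))
      (λ v → trans (cong (from σ) (from-to τ (to σ v))) (from-to σ v))
      (to-preserves τ ∘ to-preserves σ) (from-preserves σ ∘ from-preserves τ)

    Aut-inverse : Aut G a b → Aut G a b
    Aut-inverse σ = mkAut (from σ) (to σ) (from-to σ) (to-from σ) (from-preserves σ) (to-preserves σ)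

    ρ-preserves : ∀ g {u v} → u ~ v → ρ G g u ~ ρ G g v
    ρ-preserves g (edge₁ x y r) = edge₁ (x ∙ g) (y ∙ g) (subst (_≡± a) (sym (yg//xg≡y//x x y g)) r)
    ρ-preserves g (edge₂ x y r) = edge₂ (x ∙ g) (y ∙ g) (subst (_≡± b) (sym (yg//xg≡y//x x y g)) r)
    ρ-preserves g (spoke₁₂ x)   = spoke₁₂ (x ∙ g)
    ρ-preserves g (spoke₂₁ x)   = spoke₂₁ (x ∙ g)

    ρ-Aut : Fin n → Aut G a b
    ρ-Aut g = mkAut (ρ G g) (ρ G (g ⁻¹))
      (λ { (x , i) → cong (_, i) (//-rightDividesˡ g x) })
      (λ { (x , i) → cong (_, i) (//-rightDividesʳ g x) })
      (ρ-preserves g) (ρ-preserves (g ⁻¹))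

    reposition : ∀ σ {x i y j} → to σ (x , i) ≡ (y , j) →
                 ∀ p q → Σ (Aut G a b) λ τ → to τ (p , i) ≡ (q , j)
    reposition σ {x} {i} {y} {j} σxi≡yj p q =
      Aut-compose (Aut-compose (ρ-Aut (p \\ x)) σ) (ρ-Aut (y \\ q)) , (begin
        ρ G (y \\ q) (to σ (p ∙ (p \\ x) , i))  ≡⟨ cong (λ z → ρ G (y \\ q) (to σ (z , i)))
                                                        (\\-leftDividesˡ p x) ⟩
        ρ G (y \\ q) (to σ (x , i))             ≡⟨ cong (ρ G (y \\ q)) σxi≡yj ⟩
        (y ∙ (y \\ q) , j)                      ≡⟨ cong (_, j) (\\-leftDividesˡ y q) ⟩
        (q , j)                                 ∎)

    within-layer : ∀ p q i → Σ (Aut G a b) λ τ → to τ (p , i) ≡ (q , i)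
    within-layer p q i = ρ-Aut (p \\ q) , cong (_, i) (\\-leftDividesˡ p q)

    layer-swap⇒vertexTransitive : ∀ σ {x y} → to σ (x , layer₁) ≡ (y , layer₂) →
                                  VertexTransitive G a b
    layer-swap⇒vertexTransitive σ σx≡y (p , layer₁) (q , layer₁) = within-layer p q layer₁
    layer-swap⇒vertexTransitive σ σx≡y (p , layer₂) (q , layer₂) = within-layer p q layer₂
    layer-swap⇒vertexTransitive σ σx≡y (p , layer₁) (q , layer₂) = reposition σ σx≡y p q
    layer-swap⇒vertexTransitive σ σx≡y (p , layer₂) (q , layer₁) =
      reposition (Aut-inverse σ) (to≡⇒from≡ σ σx≡y) p q

    conjugate-translation : ∀ σ (F : Fin n → Fin n) → (∀ x i → to σ (x , i) ≡ (F x , i)) →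
                            ∀ g h → (∀ x → F (x ∙ h) ≡ F x ∙ g) →
                            ∀ v → from σ (ρ G g (to σ v)) ≡ ρ G h v
    conjugate-translation σ F σ-on-layers g h F[x∙h]≡F[x]∙g (x , i) = begin
      from σ (ρ G g (to σ (x , i)))  ≡⟨ cong (from σ ∘ ρ G g) (σ-on-layers x i) ⟩
      from σ (F x ∙ g , i)           ≡⟨ to≡⇒from≡ σ (trans (σ-on-layers (x ∙ h) i)
                                                           (cong (_, i) (F[x∙h]≡F[x]∙g x))) ⟩
      (x ∙ h , i)                    ∎

    module LayerSwap (conn : Connected G a b) (a²≢ε : a ² ≢ ε) (sw : Swappable a b) where

      a²≡b² : a ² ≡ b ²
      a²≡b² = proj₁ sw

      a²⁻¹≡a² : (a ²) ⁻¹ ≡ a ²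
      a²⁻¹≡a² = sym (inverseʳ-unique (a ²) (a ²) (subst (λ t → t ² ≡ ε) (sym a²≡b²) (proj₂ sw)))

      a⁴≡ε : a ² ∙ a ² ≡ ε
      a⁴≡ε = trans (cong (a ² ∙_) (sym a²⁻¹≡a²)) (inverseʳ (a ²))

      c : Fin n
      c = a // b

      c²≡ε : c ² ≡ ε
      c²≡ε = begin
        (a ∙ b ⁻¹) ∙ (a ∙ b ⁻¹)  ≡⟨ interchange a (b ⁻¹) a (b ⁻¹) ⟩
        a ² ∙ (b ⁻¹) ²           ≡⟨ cong₂ _∙_ a²≡b² (⁻¹-∙-comm b b) ⟩
        b ² ∙ (b ²) ⁻¹           ≡⟨ inverseʳ (b ²) ⟩
        ε                        ∎

      c⁻¹≡c : c ⁻¹ ≡ c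
      c⁻¹≡c = sym (inverseʳ-unique c c c²≡ε)

      generator² : ∀ {e} → Generator e → e ² ≡ a ²
      generator² (inj₁ e≡±a) = ≡±-self-inverse (≡±-² e≡±a) a²⁻¹≡a²
      generator² {e} (inj₂ e≡±b) = ≡±-self-inverse (subst (e ² ≡±_) (sym a²≡b²) (≡±-² e≡±b)) a²⁻¹≡a²

      ²-dichotomy : ∀ x → x ² ≡ ε ⊎ x ² ≡ a ²
      ²-dichotomy = generated-induction conn _ (inj₁ (identityʳ ε)) step
        where
        step : ∀ x e → Generator e → x ² ≡ ε ⊎ x ² ≡ a ² → (x ∙ e) ² ≡ ε ⊎ (x ∙ e) ² ≡ a ²
        step x e gen (inj₁ x²≡ε) = inj₂ (begin
          (x ∙ e) ²    ≡⟨ ²-∙ x e ⟩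
          x ² ∙ e ²    ≡⟨ cong₂ _∙_ x²≡ε (generator² gen) ⟩
          ε ∙ a ²      ≡⟨ identityˡ (a ²) ⟩
          a ²          ∎)
        step x e gen (inj₂ x²≡a²) = inj₁ (begin
          (x ∙ e) ²        ≡⟨ ²-∙ x e ⟩
          x ² ∙ e ²        ≡⟨ cong₂ _∙_ x²≡a² (generator² gen) ⟩
          a ² ∙ a ²        ≡⟨ a⁴≡ε ⟩
          ε                ∎)

      ψ : Fin n → Fin n
      ψ x with x ² ≟ ε
      ... | yes _ = x
      ... | no _  = x ∙ c

      ψ-even : ∀ {x} → x ² ≡ ε → ψ x ≡ x
      ψ-even {x} x²≡ε with x ² ≟ ε
      ... | yes _   = refl
      ... | no x²≢ε = ⊥-elim (x²≢ε x²≡ε)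

      ψ-odd : ∀ {x} → x ² ≡ a ² → ψ x ≡ x ∙ c
      ψ-odd {x} x²≡a² with x ² ≟ ε
      ... | yes x²≡ε = ⊥-elim (a²≢ε (trans (sym x²≡a²) x²≡ε))
      ... | no _     = refl

      x∙c∙c≡x : ∀ x → x ∙ c ∙ c ≡ x
      x∙c∙c≡x x = trans (assoc x c c) (trans (cong (x ∙_) c²≡ε) (identityʳ x))

      ψ-involutive : ∀ x → ψ (ψ x) ≡ x
      ψ-involutive x with ²-dichotomy x
      ... | inj₁ x²≡ε  = trans (cong ψ (ψ-even x²≡ε)) (ψ-even x²≡ε)
      ... | inj₂ x²≡a² = begin
        ψ (ψ x)      ≡⟨ cong ψ (ψ-odd x²≡a²) ⟩
        ψ (x ∙ c)    ≡⟨ ψ-odd [x∙c]²≡a² ⟩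
        x ∙ c ∙ c    ≡⟨ x∙c∙c≡x x ⟩
        x            ∎
        where
        [x∙c]²≡a² : (x ∙ c) ² ≡ a ²
        [x∙c]²≡a² = trans (²-∙ x c) (trans (cong₂ _∙_ x²≡a² c²≡ε) (identityʳ (a ²)))

      ψ-// : ∀ {x y} → (y // x) ² ≡ a ² → ψ y // ψ x ≡ (y // x) ∙ c
      ψ-// {x} {y} [y//x]²≡a² with ²-dichotomy x
      ... | inj₁ x²≡ε = begin
        ψ y // ψ x         ≡⟨ cong₂ _//_ (ψ-odd y²≡a²) (ψ-even x²≡ε) ⟩
        y ∙ c // x         ≡⟨ xy∙z≈xz∙y y c (x ⁻¹) ⟩
        (y // x) ∙ c       ∎
        where
        y²≡a² : y ² ≡ a ²
        y²≡a² = trans (y²≡x²∙[y//x]² x y) (trans (cong₂ _∙_ x²≡ε [y//x]²≡a²) (identityˡ (a ²)))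
      ... | inj₂ x²≡a² = begin
        ψ y // ψ x         ≡⟨ cong₂ _//_ (ψ-even y²≡ε) (ψ-odd x²≡a²) ⟩
        y ∙ (x ∙ c) ⁻¹     ≡⟨ cong (y ∙_) (⁻¹-∙-comm x c) ⟨
        y ∙ (x ⁻¹ ∙ c ⁻¹)  ≡⟨ cong (λ t → y ∙ (x ⁻¹ ∙ t)) c⁻¹≡c ⟩
        y ∙ (x ⁻¹ ∙ c)     ≡⟨ assoc y (x ⁻¹) c ⟨
        (y // x) ∙ c       ∎
        where
        y²≡ε : y ² ≡ ε
        y²≡ε = trans (y²≡x²∙[y//x]² x y) (trans (cong₂ _∙_ x²≡a² [y//x]²≡a²) a⁴≡ε)

      ≡±a⇒∙c≡±b : ∀ {e} → e ≡± a → e ∙ c ≡± b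
      ≡±a⇒∙c≡±b (inj₁ refl) = inj₁ (begin
        a ∙ (a ∙ b ⁻¹)  ≡⟨ assoc a a (b ⁻¹) ⟨
        a ² // b        ≡⟨ cong (_// b) a²≡b² ⟩
        b ² // b        ≡⟨ //-rightDividesʳ b b ⟩
        b               ∎)
      ≡±a⇒∙c≡±b (inj₂ refl) = inj₂ (\\-leftDividesʳ a (b ⁻¹))

      ≡±b⇒∙c≡±a : ∀ {e} → e ≡± b → e ∙ c ≡± a
      ≡±b⇒∙c≡±a (inj₁ refl) = inj₁ (trans (comm b c) (//-rightDividesˡ b a))
      ≡±b⇒∙c≡±a (inj₂ refl) = inj₂ (begin
        b ⁻¹ ∙ (a ∙ b ⁻¹)  ≡⟨ cong (b ⁻¹ ∙_) (comm a (b ⁻¹)) ⟩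
        b ⁻¹ ∙ (b ⁻¹ ∙ a)  ≡⟨ assoc (b ⁻¹) (b ⁻¹) a ⟨
        (b ⁻¹) ² ∙ a       ≡⟨ cong (_∙ a) (⁻¹-∙-comm b b) ⟩
        (b ²) ⁻¹ ∙ a       ≡⟨ cong (λ t → t ⁻¹ ∙ a) a²≡b² ⟨
        (a ²) ⁻¹ ∙ a       ≡⟨ cong (_∙ a) (⁻¹-∙-comm a a) ⟨
        (a ⁻¹) ² ∙ a       ≡⟨ //-rightDividesˡ a (a ⁻¹) ⟩
        a ⁻¹               ∎)

      Ψ : V G → V G
      Ψ (x , layer₁) = (ψ x , layer₂)
      Ψ (x , layer₂) = (ψ x , layer₁)

      Ψ-involutive : ∀ v → Ψ (Ψ v) ≡ v
      Ψ-involutive (x , layer₁) = cong (_, layer₁) (ψ-involutive x)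
      Ψ-involutive (x , layer₂) = cong (_, layer₂) (ψ-involutive x)

      Ψ-preserves : ∀ {u v} → u ~ v → Ψ u ~ Ψ v
      Ψ-preserves (edge₁ x y r) =
        edge₂ (ψ x) (ψ y) (subst (_≡± b) (sym (ψ-// (generator² (inj₁ r)))) (≡±a⇒∙c≡±b r))
      Ψ-preserves (edge₂ x y r) =
        edge₁ (ψ x) (ψ y) (subst (_≡± a) (sym (ψ-// (generator² (inj₂ r)))) (≡±b⇒∙c≡±a r))
      Ψ-preserves (spoke₁₂ x) = spoke₂₁ (ψ x)
      Ψ-preserves (spoke₂₁ x) = spoke₁₂ (ψ x)

      Ψ-Aut : Aut G a b
      Ψ-Aut = mkAut Ψ Ψ Ψ-involutive Ψ-involutive Ψ-preserves Ψ-preserves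

    swappable⇒vertexTransitive : Connected G a b → a ² ≢ ε → Swappable a b →
                                 VertexTransitive G a b
    swappable⇒vertexTransitive conn a²≢ε sw = layer-swap⇒vertexTransitive Ψ-Aut {ε} refl
      where open LayerSwap conn a²≢ε sw

    module LayerPreserving (¬vt : ¬ VertexTransitive G a b) (σ : Aut G a b) where

      layer-preserved : ∀ x i → proj₂ (to σ (x , i)) ≡ i
      layer-preserved x layer₁ with to σ (x , layer₁) in eq
      ... | (_ , layer₁) = refl
      ... | (_ , layer₂) = ⊥-elim (¬vt (layer-swap⇒vertexTransitive σ eq))
      layer-preserved x layer₂ with to σ (x , layer₂) in eq
      ... | (_ , layer₂) = refl
      ... | (_ , layer₁) =
        ⊥-elim (¬vt (layer-swap⇒vertexTransitive (Aut-inverse σ) (to≡⇒from≡ σ eq)))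

      F : Fin n → Fin n
      F x = proj₁ (to σ (x , layer₁))

      σ-on-layers : ∀ x i → to σ (x , i) ≡ (F x , i)
      σ-on-layers x layer₁ = cong (F x ,_) (layer-preserved x layer₁)
      σ-on-layers x layer₂ =
        trans (cong (y ,_) (layer-preserved x layer₂)) (cong (_, layer₂) (sym (spoke-ends spoke)))
        where
        y = proj₁ (to σ (x , layer₂))
        spoke : (F x , layer₁) ~ (y , layer₂)
        spoke = subst₂ _~_ (σ-on-layers x layer₁) (cong (y ,_) (layer-preserved x layer₂))
                           (to-preserves σ (spoke₁₂ x))

      F-injective : ∀ {x y} → F x ≡ F y → x ≡ y
      F-injective {x} {y} Fx≡Fy = cong proj₁ (begin
        (x , layer₁)          ≡⟨ to≡⇒from≡ σ (σ-on-layers x layer₁) ⟨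
        from σ (F x , layer₁) ≡⟨ cong (λ z → from σ (z , layer₁)) Fx≡Fy ⟩
        from σ (F y , layer₁) ≡⟨ to≡⇒from≡ σ (σ-on-layers y layer₁) ⟩
        (y , layer₁)          ∎)

      preimage : Fin n → Fin n
      preimage y = proj₁ (from σ (y , layer₁))

      F-preimage : ∀ y → F (preimage y) ≡ y
      F-preimage y =
        cong proj₁ (trans (sym (σ-on-layers (proj₁ w) (proj₂ w))) (to-from σ (y , layer₁)))
        where w = from σ (y , layer₁)

      Δa≡±a : ∀ x → Increments.Δ F a x ≡± a
      Δa≡±a x = layer₁-edge (subst₂ _~_ (σ-on-layers x layer₁) (σ-on-layers (x ∙ a) layer₁)
                                         (to-preserves σ (edge₁ x (x ∙ a) (inj₁ (xyx⁻¹≈y x a)))))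

      Δb≡±b : ∀ x → Increments.Δ F b x ≡± b
      Δb≡±b x = layer₂-edge (subst₂ _~_ (σ-on-layers x layer₂) (σ-on-layers (x ∙ b) layer₂)
                                         (to-preserves σ (edge₂ x (x ∙ b) (inj₁ (xyx⁻¹≈y x b)))))

      conjugate-is-translation : Connected G a b → a ² ≢ ε → b ² ≢ ε → ¬ Swappable a b →
                                 ∀ g → ∃[ h ] ∀ v → from σ (ρ G g (to σ v)) ≡ ρ G h v
      conjugate-is-translation conn a²≢ε b²≢ε ¬sw g =
        h , conjugate-translation σ F σ-on-layers g h F[x∙h]≡F[x]∙g
        where
        open CayleyPreserving F F-injective Δa≡±a Δb≡±b a²≢ε b²≢ε
        h = preimage (F ε ∙ g)
        Δhε≡g : Δ h ε ≡ g
        Δhε≡g = begin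
          F (ε ∙ h) // F ε        ≡⟨ cong (λ z → F z // F ε) (identityˡ h) ⟩
          F h // F ε              ≡⟨ cong (_// F ε) (F-preimage (F ε ∙ g)) ⟩
          F ε ∙ g // F ε          ≡⟨ xyx⁻¹≈y (F ε) g ⟩
          g                       ∎
        F[x∙h]≡F[x]∙g : ∀ x → F (x ∙ h) ≡ F x ∙ g
        F[x∙h]≡F[x]∙g x =
          trans (F-step h x) (cong (F x ∙_) (trans (unswappable⇒Δ-constant ¬sw conn h x) Δhε≡g))

lemma3p9 : (G : FinAbGroup) → Nontrivial G →
    (a b : Fin (FinAbGroup.n G)) →
    OrderAtLeast3 G a → OrderAtLeast3 G b →
    Disjoint± G a b →
    Connected G a b →
    ¬ VertexTransitive G a b →
    Normal G a b
lemma3p9 G _ a b o[a]≥3 o[b]≥3 _ conn ¬vt = Aut.pres ∘ ρ-Aut G a b , ρ-conjugate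
  where
  a²≢ε = orderAtLeast3⇒²≢ε G o[a]≥3
  b²≢ε = orderAtLeast3⇒²≢ε G o[b]≥3
  ρ-conjugate : ∀ σ g → ∃[ h ] ∀ v → from G a b σ (ρ G g (to G a b σ v)) ≡ ρ G h v
  ρ-conjugate σ g with swappable? G a b
  ... | yes sw  = ⊥-elim (¬vt (swappable⇒vertexTransitive G a b conn a²≢ε sw))
  ... | no ¬sw  = LayerPreserving.conjugate-is-translation G a b ¬vt σ conn a²≢ε b²≢ε ¬sw g
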